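{- Let $A$ and $B$ be $m\times m$ real or complex matrices and let $A_C$, $B_C$ be their color matrices. Then $A$ and $B$ are permutation similar if and only if $A_C$ and $B_C$ are permutation similar.
   Context: Two square matrices $A,B$ are permutation similar if there is a permutation matrix $P$ with $PAP^T=B$. Color matrices: let $\Sigma$ be the set of distinct values occurring in $A$ or $B$, $k=|\Sigma|$, and fix a bijection $\varphi:\Sigma\to\{1,\dots,k\}$; let $A'$, $B'$ be obtained from $A,B$ by applying $\varphi$ entrywise, and set $A_C=A'+m^2I+2J$, $B_C=B'+m^2I+2J$, where $I$ is the $m\times m$ identity and $J$ the $m\times m$ all-ones matrix. -}

module Defs where

open import Data.Nat using (ℕ; _+_; _*_; _≤_)
open import Data.Fin using (Fin; _≟_)
open import Data.Fin.Permutation using (Permutation′; _⟨$⟩ʳ_)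
open import Data.Product using (∃; ∃-syntax; Σ-syntax; _×_; _,_)
open import Data.Sum using (_⊎_)
open import Relation.Binary.PropositionalEquality using (_≡_)
open import Relation.Nullary using (yes; no)

Matrix : Set → ℕ → Set
Matrix S m = Fin m → Fin m → S

-- A and B are permutation similar: P A Pᵀ = B for a permutation matrix P.
-- For P with P_{i,σ(i)} = 1 we have (P A Pᵀ)_{ij} = A_{σ(i) σ(j)}.
PermSimilar : {S : Set} {m : ℕ} → Matrix S m → Matrix S m → Set
PermSimilar {m = m} A B =
  Σ[ σ ∈ Permutation′ m ] (∀ i j → B i j ≡ A (σ ⟨$⟩ʳ i) (σ ⟨$⟩ʳ j))

mapM : {S T : Set} {m : ℕ} → (S → T) → Matrix S m → Matrix T m
mapM f A i j = f (A i j)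

Iₘ : {m : ℕ} → Matrix ℕ m
Iₘ i j with i ≟ j
... | yes _ = 1
... | no _ = 0

Jₘ : {m : ℕ} → Matrix ℕ m
Jₘ i j = 1

_⊕_ : {m : ℕ} → Matrix ℕ m → Matrix ℕ m → Matrix ℕ m
(A ⊕ B) i j = A i j + B i j

_⊙_ : {m : ℕ} → ℕ → Matrix ℕ m → Matrix ℕ m
(c ⊙ A) i j = c * A i j

Occurs : {S : Set} {m : ℕ} → Matrix S m → Matrix S m → S → Set
Occurs A B x = (∃[ i ] ∃[ j ] A i j ≡ x) ⊎ (∃[ i ] ∃[ j ] B i j ≡ x)

IsColoring : {S : Set} {m : ℕ} → Matrix S m → Matrix S m → ℕ → (S → ℕ) → Set
IsColoring A B k φ =
  (∀ x → Occurs A B x → 1 ≤ φ x × φ x ≤ k)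
  × (∀ x y → Occurs A B x → Occurs A B y → φ x ≡ φ y → x ≡ y)
  × (∀ c → 1 ≤ c → c ≤ k → ∃[ x ] (Occurs A B x × φ x ≡ c))

colorMatrix : {S : Set} {m : ℕ} → (S → ℕ) → Matrix S m → Matrix ℕ m
colorMatrix {m = m} φ A = (mapM φ A ⊕ ((m * m) ⊙ Iₘ)) ⊕ (2 ⊙ Jₘ)

module Submission where

-- A simultaneous permutation of rows and columns fixes I and J, so it commutes with
-- adding m² I + 2 J, and that shift can also be cancelled entrywise. Applying φ entrywise
-- commutes with the permutation, and since φ is injective on the entries of A and B it can
-- be undone on them. Hence the same permutation witnesses both sides.

open import Defs
open import Data.Nat using (ℕ; _+_; _*_)
open import Data.Nat.Properties using (+-cancelʳ-≡)
open import Data.Product using (_×_; _,_)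
open import Data.Sum using (inj₁; inj₂)
open import Data.Fin using (_≟_)
open import Data.Fin.Permutation using (Permutation′; _⟨$⟩ʳ_)
open import Function.Bundles using (Injection)
open import Function.Properties.Inverse using (↔⇒↣)
open import Relation.Binary.PropositionalEquality using (_≡_; refl; sym; trans; cong; cong₂)
open import Relation.Nullary using (yes; no; contradiction)

-- A record rather than the bare Π-type of PermSimilar, so that the matrices can be
-- inferred from it by unification.
record Conjugates {S : Set} {m : ℕ} (σ : Permutation′ m) (A B : Matrix S m) : Set where
  constructor conjugates
  field entry : ∀ i j → B i j ≡ A (σ ⟨$⟩ʳ i) (σ ⟨$⟩ʳ j)

open Conjugates

module _ {m : ℕ} (σ : Permutation′ m) where

  Iₘ-conjugates : Conjugates σ Iₘ Iₘ
  Iₘ-conjugates = conjugates entry-Iₘ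
    where
    entry-Iₘ : ∀ i j → Iₘ i j ≡ Iₘ (σ ⟨$⟩ʳ i) (σ ⟨$⟩ʳ j)
    entry-Iₘ i j with i ≟ j | (σ ⟨$⟩ʳ i) ≟ (σ ⟨$⟩ʳ j)
    ... | yes _   | yes _    = refl
    ... | no _    | no _     = refl
    ... | yes i≡j | no σi≢σj  = contradiction (cong (σ ⟨$⟩ʳ_) i≡j) σi≢σj
    ... | no i≢j  | yes σi≡σj = contradiction (Injection.injective (↔⇒↣ σ) σi≡σj) i≢j

  Jₘ-conjugates : Conjugates σ Jₘ Jₘ
  Jₘ-conjugates = conjugates λ i j → refl

  ⊙-conjugates : ∀ c {A B : Matrix ℕ m} → Conjugates σ A B → Conjugates σ (c ⊙ A) (c ⊙ B)
  ⊙-conjugates c AB = conjugates λ i j → cong (c *_) (entry AB i j)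

  ⊕-conjugates : {A B C D : Matrix ℕ m} →
                 Conjugates σ A B → Conjugates σ C D → Conjugates σ (A ⊕ C) (B ⊕ D)
  ⊕-conjugates AB CD = conjugates λ i j → cong₂ _+_ (entry AB i j) (entry CD i j)

  ⊕-cancelʳ-conjugates : {A B C D : Matrix ℕ m} →
                         Conjugates σ C D → Conjugates σ (A ⊕ C) (B ⊕ D) → Conjugates σ A B
  ⊕-cancelʳ-conjugates {A} {B} {C} {D} CD AC-BD = conjugates cancelled
    where
    cancelled : ∀ i j → B i j ≡ A (σ ⟨$⟩ʳ i) (σ ⟨$⟩ʳ j)
    cancelled i j = +-cancelʳ-≡ (D i j) (B i j) (A (σ ⟨$⟩ʳ i) (σ ⟨$⟩ʳ j))
      (trans (entry AC-BD i j) (cong (A (σ ⟨$⟩ʳ i) (σ ⟨$⟩ʳ j) +_) (sym (entry CD i j))))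

  mapM-conjugates : {S T : Set} (f : S → T) {A B : Matrix S m} →
                    Conjugates σ A B → Conjugates σ (mapM f A) (mapM f B)
  mapM-conjugates f AB = conjugates λ i j → cong f (entry AB i j)

  mapM-conjugates⁻¹ : {S T : Set} (f : S → T) {A B : Matrix S m} →
                      (∀ x y → Occurs A B x → Occurs A B y → f x ≡ f y → x ≡ y) →
                      Conjugates σ (mapM f A) (mapM f B) → Conjugates σ A B
  mapM-conjugates⁻¹ f f-inj fAB = conjugates λ i j →
    f-inj _ _ (inj₂ (i , j , refl)) (inj₁ (σ ⟨$⟩ʳ i , σ ⟨$⟩ʳ j , refl)) (entry fAB i j)

  scaled-Iₘ-conjugates : Conjugates σ ((m * m) ⊙ Iₘ) ((m * m) ⊙ Iₘ)
  scaled-Iₘ-conjugates = ⊙-conjugates (m * m) Iₘ-conjugates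

  scaled-Jₘ-conjugates : Conjugates σ (2 ⊙ Jₘ) (2 ⊙ Jₘ)
  scaled-Jₘ-conjugates = ⊙-conjugates 2 Jₘ-conjugates

  colorMatrix-conjugates : {S : Set} (φ : S → ℕ) {A B : Matrix S m} →
                           Conjugates σ A B → Conjugates σ (colorMatrix φ A) (colorMatrix φ B)
  colorMatrix-conjugates φ AB =
    ⊕-conjugates (⊕-conjugates (mapM-conjugates φ AB) scaled-Iₘ-conjugates) scaled-Jₘ-conjugates

  colorMatrix-conjugates⁻¹ : {S : Set} (φ : S → ℕ) {A B : Matrix S m} →
                             (∀ x y → Occurs A B x → Occurs A B y → φ x ≡ φ y → x ≡ y) →
                             Conjugates σ (colorMatrix φ A) (colorMatrix φ B) → Conjugates σ A B
  colorMatrix-conjugates⁻¹ φ φ-inj CA-CB =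
    mapM-conjugates⁻¹ φ φ-inj
      (⊕-cancelʳ-conjugates scaled-Iₘ-conjugates (⊕-cancelʳ-conjugates scaled-Jₘ-conjugates CA-CB))

theorem3 : (S : Set) (m : ℕ) (A B : Matrix S m) (k : ℕ) (φ : S → ℕ)
    → IsColoring A B k φ
    → (PermSimilar A B → PermSimilar (colorMatrix φ A) (colorMatrix φ B))
      × (PermSimilar (colorMatrix φ A) (colorMatrix φ B) → PermSimilar A B)
theorem3 S m A B k φ (_ , φ-inj , _) =
  (λ (σ , AB) → σ , entry (colorMatrix-conjugates σ φ (conjugates {A = A} AB))) ,
  (λ (σ , CA-CB) → σ , entry (colorMatrix-conjugates⁻¹ σ φ φ-inj (conjugates CA-CB)))
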